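{- Let $r\ge 1$ and $1\le k\le r$ be integers. Then $H_{r,k}\equiv 0\pmod 2$ if and only if $r\equiv 1\pmod 3$.
   Context: $F_n$ denotes the Fibonacci numbers ($F_0=0$, $F_1=1$, $F_{n}=F_{n-1}+F_{n-2}$), extended to negative indices by $F_{ -n}=(-1)^{n-1}F_n$. For integers $r,k$, $H_{r,k}=F_{k+1}F_{r-k+2}-F_kF_{r-k+1}=F_{k-1}F_{r-k+2}+F_kF_{r-k}$ (the entry in row $r$, position $k$ of the determinant Hosoya triangle). -}

module Defs where

open import Data.Nat using (ℕ; zero; suc)
open import Data.Integer using (ℤ; +_; -[1+_]; _+_; _-_; _*_; -_)

fibℕ : ℕ → ℤ
fibℕ zero = + 0
fibℕ (suc zero) = + 1
fibℕ (suc (suc n)) = fibℕ (suc n) + fibℕ n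

-- sign (-1)^(n-1) for n ≥ 1, written for m = n - 1: (-1)^m
negOnePow : ℕ → ℤ
negOnePow zero = + 1
negOnePow (suc m) = - negOnePow m

-- Fibonacci numbers extended to ℤ: F (-n) = (-1)^(n-1) F n
F : ℤ → ℤ
F (+ n) = fibℕ n
F -[1+ m ] = negOnePow m * fibℕ (suc m)

H : ℤ → ℤ → ℤ
H r k = F (k + + 1) * F (r - k + + 2) - F k * F (r - k + + 1)

-- Modulo 2 the Fibonacci numbers run through 0, 1, 1 with period 3. Hence, writing
-- r = k + m, the entry H_{r,k} = F_{k+1} F_{m+2} - F_k F_{m+1} is congruent mod 2 to the
-- same expression in that pattern, which depends only on k and m modulo 3, and the
-- nine residue pairs are settled by computation.
module Submission where

open import Defs
open import Data.Integer using (ℤ; +_; _≤_)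
open import Data.Integer.Divisibility using (_∣_)
open import Data.Integer.DivMod using (_%ℕ_)
open import Function.Bundles using (_⇔_)
open import Relation.Binary.PropositionalEquality using (_≡_)

open import Data.Nat as ℕ using (ℕ; zero; suc; _∸_)
open import Data.Nat.Properties using (+-comm; m+[n∸m]≡n)
open import Data.Nat.DivMod using (_%_)
open import Data.Nat.Divisibility using (_∣?_)
open import Data.Integer using (_+_; _-_; _*_; -_; +≤+)
open import Data.Integer.Divisibility.Signed using (divides; ∣ᵤ⇒∣; ∣⇒∣ᵤ; ∣m∣n⇒∣m+n; ∣m+n∣m⇒∣n)
open import Data.Integer.Tactic.RingSolver using (solve-∀)
open import Data.Product using (Σ; _,_)
open import Data.Empty using (⊥-elim)
open import Function.Bundles using (mk⇔)
open import Function.Construct.Composition using (_⇔-∘_)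
open import Relation.Nullary using (Dec; does; yes; no)
open import Relation.Binary.PropositionalEquality using (refl; trans; cong; cong₂; subst)

infix 4 _≡_mod_

_≡_mod_ : ℤ → ℤ → ℤ → Set
_≡_mod_ x y n = Σ ℤ λ q → x ≡ q * n + y

≡mod-trans : ∀ {x y z n} → x ≡ y mod n → y ≡ z mod n → x ≡ z mod n
≡mod-trans {z = z} {n} (q , refl) (p , refl) = q + p , regroup q p n z
  where
  regroup : ∀ q p n z → q * n + (p * n + z) ≡ (q + p) * n + z
  regroup = solve-∀

+-cong-mod : ∀ {x y u v n} → x ≡ y mod n → u ≡ v mod n → x + u ≡ y + v mod n
+-cong-mod {y = y} {v = v} {n} (q , refl) (p , refl) = q + p , regroup q p n y v
  where
  regroup : ∀ q p n y v → (q * n + y) + (p * n + v) ≡ (q + p) * n + (y + v)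
  regroup = solve-∀

-‿cong-mod : ∀ {x y n} → x ≡ y mod n → - x ≡ - y mod n
-‿cong-mod {y = y} {n} (q , refl) = - q , regroup q n y
  where
  regroup : ∀ q n y → - (q * n + y) ≡ (- q) * n + - y
  regroup = solve-∀

*-cong-mod : ∀ {x y u v n} → x ≡ y mod n → u ≡ v mod n → x * u ≡ y * v mod n
*-cong-mod {y = y} {v = v} {n} (q , refl) (p , refl) = q * p * n + q * v + y * p , regroup q p n y v
  where
  regroup : ∀ q p n y v → (q * n + y) * (p * n + v) ≡ (q * p * n + q * v + y * p) * n + y * v
  regroup = solve-∀

∣-respects-≡mod : ∀ {x y n} → x ≡ y mod n → (n ∣ x) ⇔ (n ∣ y)
∣-respects-≡mod (q , refl) = mk⇔
  (λ n∣x → ∣⇒∣ᵤ (∣m+n∣m⇒∣n (∣ᵤ⇒∣ n∣x) (divides q refl)))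
  (λ n∣y → ∣⇒∣ᵤ (∣m∣n⇒∣m+n (divides q refl) (∣ᵤ⇒∣ n∣y)))

does-≡⇒⇔ : ∀ {p q} {P : Set p} {Q : Set q} (P? : Dec P) (Q? : Dec Q) → does P? ≡ does Q? → P ⇔ Q
does-≡⇒⇔ (yes p) (yes q) _ = mk⇔ (λ _ → q) (λ _ → p)
does-≡⇒⇔ (no ¬p) (no ¬q) _ = mk⇔ (λ p → ⊥-elim (¬p p)) (λ q → ⊥-elim (¬q q))
does-≡⇒⇔ (yes _) (no _) ()
does-≡⇒⇔ (no _) (yes _) ()

fibMod2 : ℕ → ℤ
fibMod2 0 = + 0
fibMod2 1 = + 1
fibMod2 2 = + 1
fibMod2 (suc (suc (suc n))) = fibMod2 n

fibMod2-rec : ∀ n → fibMod2 (suc n) + fibMod2 n ≡ fibMod2 (suc (suc n)) mod + 2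
fibMod2-rec 0 = + 0 , refl
fibMod2-rec 1 = + 1 , refl
fibMod2-rec 2 = + 0 , refl
fibMod2-rec (suc (suc (suc n))) = fibMod2-rec n

fib≡fibMod2 : ∀ n → fibℕ n ≡ fibMod2 n mod + 2
fib≡fibMod2 0 = + 0 , refl
fib≡fibMod2 1 = + 0 , refl
fib≡fibMod2 (suc (suc n)) =
  ≡mod-trans (+-cong-mod (fib≡fibMod2 (suc n)) (fib≡fibMod2 n)) (fibMod2-rec n)

-- hosoya f a m is H_{a+1+m, a+1} with F replaced by f.
hosoya : (ℕ → ℤ) → ℕ → ℕ → ℤ
hosoya f a m = f (suc (suc a)) * f (suc (suc m)) - f (suc a) * f (suc m)

hosoya-cong-mod : ∀ {f g n} → (∀ i → f i ≡ g i mod n) → ∀ a m → hosoya f a m ≡ hosoya g a m mod n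
hosoya-cong-mod f≡g a m =
  +-cong-mod (*-cong-mod (f≡g _) (f≡g _)) (-‿cong-mod (*-cong-mod (f≡g _) (f≡g _)))

H-shift : ∀ k s → H (k + s) k ≡ F (k + + 1) * F (+ 2 + s) - F k * F (+ 1 + s)
H-shift k s = cong₂ (λ u v → F (k + + 1) * F u - F k * F v) (cancel k s (+ 2)) (cancel k s (+ 1))
  where
  cancel : ∀ k s j → k + s - k + j ≡ j + s
  cancel = solve-∀

H≡hosoya-fib : ∀ a m → H (+ (suc a ℕ.+ m)) (+ suc a) ≡ hosoya fibℕ a m
H≡hosoya-fib a m = trans (H-shift (+ suc a) (+ m))
  (cong (λ i → fibℕ i * fibℕ (suc (suc m)) - fibℕ (suc a) * fibℕ (suc m)) (+-comm (suc a) 1))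

hosoya-fibMod2-even⇔ : ∀ a m → (+ 2 ∣ hosoya fibMod2 a m) ⇔ ((suc a ℕ.+ m) % 3 ≡ 1)
-- Both fibMod2 and _% 3 are 3-periodic by computation, so lowering a or m by 3
-- changes neither side (up to reassociating the sum).
hosoya-fibMod2-even⇔ (suc (suc (suc a))) m = hosoya-fibMod2-even⇔ a m
hosoya-fibMod2-even⇔ a (suc (suc (suc m))) =
  subst (λ s → (+ 2 ∣ hosoya fibMod2 a m) ⇔ (s % 3 ≡ 1)) shift (hosoya-fibMod2-even⇔ a m)
  where
  shift : 3 ℕ.+ (suc a ℕ.+ m) ≡ suc a ℕ.+ (3 ℕ.+ m)
  shift = trans (cong (3 ℕ.+_) (+-comm (suc a) m)) (+-comm (3 ℕ.+ m) (suc a))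
hosoya-fibMod2-even⇔ 0 0 = does-≡⇒⇔ (_ ∣? _) (_ ℕ.≟ _) refl
hosoya-fibMod2-even⇔ 0 1 = does-≡⇒⇔ (_ ∣? _) (_ ℕ.≟ _) refl
hosoya-fibMod2-even⇔ 0 2 = does-≡⇒⇔ (_ ∣? _) (_ ℕ.≟ _) refl
hosoya-fibMod2-even⇔ 1 0 = does-≡⇒⇔ (_ ∣? _) (_ ℕ.≟ _) refl
hosoya-fibMod2-even⇔ 1 1 = does-≡⇒⇔ (_ ∣? _) (_ ℕ.≟ _) refl
hosoya-fibMod2-even⇔ 1 2 = does-≡⇒⇔ (_ ∣? _) (_ ℕ.≟ _) refl
hosoya-fibMod2-even⇔ 2 0 = does-≡⇒⇔ (_ ∣? _) (_ ℕ.≟ _) refl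
hosoya-fibMod2-even⇔ 2 1 = does-≡⇒⇔ (_ ∣? _) (_ ℕ.≟ _) refl
hosoya-fibMod2-even⇔ 2 2 = does-≡⇒⇔ (_ ∣? _) (_ ℕ.≟ _) refl

H-even⇔ : ∀ a m → (+ 2 ∣ H (+ (suc a ℕ.+ m)) (+ suc a)) ⇔ ((suc a ℕ.+ m) % 3 ≡ 1)
H-even⇔ a m rewrite H≡hosoya-fib a m =
  hosoya-fibMod2-even⇔ a m ⇔-∘ ∣-respects-≡mod (hosoya-cong-mod fib≡fibMod2 a m)

proposition2p4 : (r k : ℤ) → + 1 ≤ r → + 1 ≤ k → k ≤ r →
    ((+ 2 ∣ H r k) ⇔ (r %ℕ 3 ≡ 1))
proposition2p4 (+ n) (+ suc a) _ _ (+≤+ k≤n) =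
  subst (λ r → (+ 2 ∣ H (+ r) (+ suc a)) ⇔ (r % 3 ≡ 1)) (m+[n∸m]≡n k≤n) (H-even⇔ a (n ∸ suc a))
proposition2p4 (+ n) (+ zero) _ (+≤+ ()) _
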